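{- For positive integers $n,k,i$ with $1\le i\le k-1\le n-1$, the number $S(n,k)\big\langle {k-1 \atop i}\big\rangle$ equals the number of cyclically ordered partitions of $\{1,\dots,n\}$ with $k$ blocks whose list of openers contains exactly $i-1$ descents.
   Context: $S(n,k)$ is the Stirling number of the second kind (number of partitions of $\{1,\dots,n\}$ into $k$ blocks). The Eulerian number $\big\langle {m \atop i}\big\rangle$ ($1\le i\le m$) is the number of permutations of $\{1,\dots,m\}$ with exactly $i-1$ descents, a descent of a list $w_1\cdots w_m$ being a position $r$ with $w_r>w_{r+1}$. A cyclically ordered partition of $\{1,\dots,n\}$ is a set partition of $\{1,\dots,n\}$ whose blocks are endowed with a cyclic order; it is represented canonically as a list of blocks in which the first block contains the element $1$ (the remaining blocks listed in the cyclic order starting from it) and each block is written as an increasing list. E.g. the cyclically ordered partitions of $\{1,2,3\}$ are $(123),(12)(3),(13)(2),(1)(23),(1)(2)(3),(1)(3)(2)$. The opener of a block is its least element, and the list of openers of a cyclically ordered partition is the list of the openers of its blocks in the canonical order (e.g. $(13)(2)$ has list of openers $12$ and $(1)(3)(2)$ has list $132$). -}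

module Defs where

open import Data.Nat using (ℕ; zero; suc; _+_; _*_; _<ᵇ_; _≡ᵇ_)
open import Data.Bool using (Bool; true; false; _∧_; not; if_then_else_)
open import Data.List using (List; []; _∷_; map; concatMap; length; filterᵇ; upTo)
open import Data.Bool.ListAction using (all; any)
open import Data.Maybe using (Maybe; just; nothing)

S : ℕ → ℕ → ℕ
S zero    zero    = 1
S zero    (suc k) = 0
S (suc n) zero    = 0
S (suc n) (suc k) = suc k * S n (suc k) + S n k

words : ℕ → ℕ → List (List ℕ)
words zero    k = [] ∷ []
words (suc n) k = concatMap (λ a → map (a ∷_) (words n k)) (upTo k)

descents : List ℕ → ℕ
descents []           = 0
descents (x ∷ [])     = 0
descents (x ∷ y ∷ ws) = (if y <ᵇ x then 1 else 0) + descents (y ∷ ws)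

distinct : List ℕ → Bool
distinct []       = true
distinct (x ∷ xs) = not (any (λ y → x ≡ᵇ y) xs) ∧ distinct xs

-- permutations of {1,…,m}, written (shifted by one) as words over {0,…,m-1}
permutations : ℕ → List (List ℕ)
permutations m = filterᵇ distinct (words m m)

eulerian : ℕ → ℕ → ℕ
eulerian m i = length (filterᵇ (λ w → descents w ≡ᵇ (i Data.Nat.∸ 1)) (permutations m))

-- A cyclically ordered partition of {1,…,n} with k blocks, in canonical form
-- (list of blocks B₀ B₁ … B_{k-1}, with 1 ∈ B₀), is encoded by its block-index word
-- b₁⋯b_n over {0,…,k-1}: element p lies in block B_{b_p}.  The word is valid iff
-- every block is nonempty (surjectivity) and element 1 lies in block B₀ (b₁ = 0).

-- position (1-based element of {1,…,n}) of the first occurrence of a in the word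
firstOcc : ℕ → List ℕ → Maybe ℕ
firstOcc a []       = nothing
firstOcc a (b ∷ bs) with a ≡ᵇ b
... | true  = just 1
... | false with firstOcc a bs
...   | just p  = just (suc p)
...   | nothing = nothing

isJust : Maybe ℕ → Bool
isJust (just _) = true
isJust nothing  = false

surjective : ℕ → List ℕ → Bool
surjective k w = all (λ a → isJust (firstOcc a w)) (upTo k)

startsWithZero : List ℕ → Bool
startsWithZero []       = false
startsWithZero (b ∷ bs) = b ≡ᵇ 0

cyclicPartitions : ℕ → ℕ → List (List ℕ)
cyclicPartitions n k = filterᵇ (λ w → startsWithZero w ∧ surjective k w) (words n k)

fromMaybe0 : Maybe ℕ → ℕ
fromMaybe0 (just p) = p
fromMaybe0 nothing  = 0

-- list of openers: least element of each block, blocks in canonical order B₀ … B_{k-1}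
openers : ℕ → List ℕ → List ℕ
openers k w = map (λ a → fromMaybe0 (firstOcc a w)) (upTo k)

cycPartCount : ℕ → ℕ → ℕ → ℕ
cycPartCount n k d = length (filterᵇ (λ w → descents (openers k w) ≡ᵇ d) (cyclicPartitions n k))

-- A word w of length n over {0,…,k-1} records the block of each element; dedup w lists the
-- blocks in the order in which they are opened. For an arrangement σ of the k labels exactly
-- S(n,k) words have dedup w = σ, and the openers of w are ordered like the inverse
-- permutation of σ. So the count is S(n,k) times the number of permutations σ of {0,…,k-1}
-- with σ₀ = 0 whose inverse has i-1 descents; deleting the fixed point 0 and inverting
-- matches these with the permutations of k-1 letters with i-1 descents.
module Submission where

open import Defs
open import Algebra.Properties.CommutativeSemigroup using (interchange)
open import Data.Bool using (Bool; true; false; _∧_; _∨_; not; if_then_else_)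
open import Data.Bool.ListAction using (and; all; any)
open import Data.Bool.Properties using (T-≡; ∨-zeroʳ)
open import Data.List
  using (List; []; _∷_; _++_; map; concat; concatMap; length; filter; filterᵇ; upTo; applyUpTo; deduplicateᵇ)
open import Data.List.Properties
  using ( ≡-dec; ∷-injectiveʳ; map-injective; map-upTo; map-∘; map-cong; map-cong-local; map-id; map-id-local
        ; length-map; length-upTo; length-filter)
open import Data.List.Relation.Unary.All using (All; []; _∷_)
import Data.List.Relation.Unary.All as All
import Data.List.Relation.Unary.All.Properties as All
open import Data.Maybe using (just; nothing)
open import Data.Nat using (ℕ; zero; suc; pred; _+_; _*_; _∸_; _≤_; _<_; _<ᵇ_; _≡ᵇ_; z≤n; s≤s)
open import Data.Nat.Properties
open import Data.Product using (_×_; _,_; proj₁; proj₂; ∃)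
open import Data.Sum using (_⊎_; inj₁; inj₂)
open import Data.Unit using (⊤; tt)
open import Function using (_∘_; id)
open import Function.Bundles using (mk⇔; Equivalence)
open import Relation.Binary.Definitions using (DecidableEquality)
open import Relation.Binary.PropositionalEquality
open import Relation.Nullary using (yes; no; does; proof; contradiction; ¬?)
open import Relation.Nullary.Decidable using (T?; dec-true; does-⇔)
open import Relation.Nullary.Reflects using (Reflects; ofʸ)
open ≡-Reasoning

+-interchange : ∀ a b c d → (a + b) + (c + d) ≡ (a + c) + (b + d)
+-interchange = interchange +-commutativeSemigroup

𝟙 : Bool → ℕ
𝟙 true  = 1
𝟙 false = 0

𝟙-∧ : ∀ a b → 𝟙 (a ∧ b) ≡ 𝟙 a * 𝟙 b
𝟙-∧ true  b = sym (*-identityˡ (𝟙 b))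
𝟙-∧ false b = refl

∑ : {A : Set} → List A → (A → ℕ) → ℕ
∑ []       f = 0
∑ (x ∷ xs) f = f x + ∑ xs f

infix 6.5 ∑
syntax ∑ xs (λ x → e) = ∑[ x ∈ xs ] e

module _ {A : Set} where

  ∑-cong : ∀ xs {f g : A → ℕ} → (∀ x → f x ≡ g x) → ∑ xs f ≡ ∑ xs g
  ∑-cong []       f≗g = refl
  ∑-cong (x ∷ xs) f≗g = cong₂ _+_ (f≗g x) (∑-cong xs f≗g)

  ∑-cong-local : ∀ {xs} {f g : A → ℕ} → All (λ x → f x ≡ g x) xs → ∑ xs f ≡ ∑ xs g
  ∑-cong-local []             = refl
  ∑-cong-local (fx≡gx ∷ rest) = cong₂ _+_ fx≡gx (∑-cong-local rest)

  ∑-const : ∀ (xs : List A) c → ∑[ x ∈ xs ] c ≡ length xs * c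
  ∑-const []       c = refl
  ∑-const (x ∷ xs) c = cong (c +_) (∑-const xs c)

  ∑-zero : ∀ (xs : List A) → ∑[ x ∈ xs ] 0 ≡ 0
  ∑-zero xs = trans (∑-const xs 0) (*-zeroʳ (length xs))

  ∑-++ : ∀ xs ys (f : A → ℕ) → ∑ (xs ++ ys) f ≡ ∑ xs f + ∑ ys f
  ∑-++ []       ys f = refl
  ∑-++ (x ∷ xs) ys f = trans (cong (f x +_) (∑-++ xs ys f)) (sym (+-assoc (f x) _ _))

  ∑-concat : ∀ xss (f : A → ℕ) → ∑ (concat xss) f ≡ ∑[ xs ∈ xss ] ∑ xs f
  ∑-concat []         f = refl
  ∑-concat (xs ∷ xss) f = trans (∑-++ xs (concat xss) f) (cong (∑ xs f +_) (∑-concat xss f))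

  ∑-distrib-+ : ∀ xs (f g : A → ℕ) → ∑[ x ∈ xs ] (f x + g x) ≡ ∑ xs f + ∑ xs g
  ∑-distrib-+ []       f g = refl
  ∑-distrib-+ (x ∷ xs) f g =
    trans (cong (f x + g x +_) (∑-distrib-+ xs f g)) (+-interchange (f x) (g x) _ _)

  ∑-distribˡ : ∀ xs c (f : A → ℕ) → ∑[ x ∈ xs ] c * f x ≡ c * ∑ xs f
  ∑-distribˡ []       c f = sym (*-zeroʳ c)
  ∑-distribˡ (x ∷ xs) c f =
    trans (cong (c * f x +_) (∑-distribˡ xs c f)) (sym (*-distribˡ-+ c (f x) _))

  ∑-distribʳ : ∀ xs c (f : A → ℕ) → ∑[ x ∈ xs ] f x * c ≡ ∑ xs f * c
  ∑-distribʳ xs c f =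
    trans (∑-cong xs (λ x → *-comm (f x) c)) (trans (∑-distribˡ xs c f) (*-comm c _))

  ∑-filterᵇ : ∀ (p : A → Bool) xs f → ∑ (filterᵇ p xs) f ≡ ∑[ x ∈ xs ] 𝟙 (p x) * f x
  ∑-filterᵇ p []       f = refl
  ∑-filterᵇ p (x ∷ xs) f with p x
  ... | true  = cong₂ _+_ (sym (+-identityʳ (f x))) (∑-filterᵇ p xs f)
  ... | false = ∑-filterᵇ p xs f

  length-filterᵇ : ∀ (p : A → Bool) xs → length (filterᵇ p xs) ≡ ∑[ x ∈ xs ] 𝟙 (p x)
  length-filterᵇ p []       = refl
  length-filterᵇ p (x ∷ xs) with p x
  ... | true  = cong suc (length-filterᵇ p xs)
  ... | false = length-filterᵇ p xs

module _ {A B : Set} where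

  ∑-map : ∀ (g : A → B) xs f → ∑ (map g xs) f ≡ ∑[ x ∈ xs ] f (g x)
  ∑-map g []       f = refl
  ∑-map g (x ∷ xs) f = cong (f (g x) +_) (∑-map g xs f)

  ∑-comm : ∀ xs ys (f : A → B → ℕ) → ∑[ x ∈ xs ] ∑ ys (f x) ≡ ∑[ y ∈ ys ] ∑[ x ∈ xs ] f x y
  ∑-comm []       ys f = sym (∑-zero ys)
  ∑-comm (x ∷ xs) ys f =
    trans (cong (∑ ys (f x) +_) (∑-comm xs ys f)) (sym (∑-distrib-+ ys (f x) _))

∑-concatMap : {A B : Set} (g : A → List B) (xs : List A) (f : B → ℕ) →
  ∑ (concatMap g xs) f ≡ ∑[ x ∈ xs ] ∑ (g x) f
∑-concatMap g xs f = trans (∑-concat (map g xs) f) (∑-map g xs (λ ys → ∑ ys f))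

∑-upTo-suc : ∀ m f → ∑ (upTo (suc m)) f ≡ f 0 + (∑[ a ∈ upTo m ] f (suc a))
∑-upTo-suc m f = cong (f 0 +_) (trans (cong (λ as → ∑ as f) (sym (map-upTo suc m))) (∑-map suc (upTo m) f))

∑-upTo-select : ∀ K b (h : ℕ → ℕ) → b < K → ∑[ a ∈ upTo K ] 𝟙 (b ≡ᵇ a) * h a ≡ h b
∑-upTo-select (suc K) zero    h _ = begin
  ∑[ a ∈ upTo (suc K) ] 𝟙 (0 ≡ᵇ a) * h a  ≡⟨ ∑-upTo-suc K (λ a → 𝟙 (0 ≡ᵇ a) * h a) ⟩
  h 0 + 0 + (∑[ a ∈ upTo K ] 0)             ≡⟨ cong₂ _+_ (+-identityʳ (h 0)) (∑-zero (upTo K)) ⟩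
  h 0 + 0                                  ≡⟨ +-identityʳ (h 0) ⟩
  h 0                                      ∎
∑-upTo-select (suc K) (suc b) h (s≤s b<K) =
  trans (∑-upTo-suc K (λ a → 𝟙 (suc b ≡ᵇ a) * h a)) (∑-upTo-select K b (h ∘ suc) b<K)

∑-upTo-select-∧ : ∀ {A : Set} K b (xs : List A) (g : ℕ → A → Bool) → b < K →
  ∑[ a ∈ upTo K ] ∑[ x ∈ xs ] 𝟙 ((b ≡ᵇ a) ∧ g a x) ≡ ∑[ x ∈ xs ] 𝟙 (g b x)
∑-upTo-select-∧ K b xs g b<K = trans (∑-cong (upTo K) factor) (∑-upTo-select K b _ b<K)
  where
  factor : ∀ a → ∑[ x ∈ xs ] 𝟙 ((b ≡ᵇ a) ∧ g a x) ≡ 𝟙 (b ≡ᵇ a) * (∑[ x ∈ xs ] 𝟙 (g a x))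
  factor a = trans (∑-cong xs (λ x → 𝟙-∧ (b ≡ᵇ a) (g a x))) (∑-distribˡ xs (𝟙 (b ≡ᵇ a)) _)

module Multiplicity {A : Set} (_≟_ : DecidableEquality A) where

  multiplicity : A → List A → ℕ
  multiplicity x ys = ∑[ y ∈ ys ] 𝟙 (does (x ≟ y))

  multiplicity-map : ∀ {X : Set} (f : X → A) y xs →
    multiplicity y (map f xs) ≡ ∑[ x ∈ xs ] 𝟙 (does (f x ≟ y))
  multiplicity-map f y xs =
    trans (∑-map f xs _) (∑-cong xs (λ x → cong 𝟙 (does-⇔ (mk⇔ sym sym) (y ≟ f x) (f x ≟ y))))

  ∑-select : ∀ x ys (h : A → ℕ) → ∑[ y ∈ ys ] 𝟙 (does (x ≟ y)) * h y ≡ multiplicity x ys * h x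
  ∑-select x []       h = refl
  ∑-select x (y ∷ ys) h with x ≟ y
  ... | yes refl = cong₂ _+_ (+-identityʳ (h x)) (∑-select x ys h)
  ... | no  _    = ∑-select x ys h

  ∑-fibres : ∀ {X : Set} (f : X → A) (h : A → ℕ) {xs : List X} ys →
    All (λ x → h (f x) ≡ 0 ⊎ multiplicity (f x) ys ≡ 1) xs →
    ∑[ x ∈ xs ] h (f x) ≡ ∑[ y ∈ ys ] multiplicity y (map f xs) * h y
  ∑-fibres f h {xs} ys at-most-once = begin
    ∑[ x ∈ xs ] h (f x)
      ≡⟨ ∑-cong-local (All.map expand at-most-once) ⟩
    ∑[ x ∈ xs ] (∑[ y ∈ ys ] 𝟙 (does (f x ≟ y)) * h y)
      ≡⟨ ∑-comm xs ys _ ⟩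
    ∑[ y ∈ ys ] (∑[ x ∈ xs ] 𝟙 (does (f x ≟ y)) * h y)
      ≡⟨ ∑-cong ys (λ y → ∑-distribʳ xs (h y) _) ⟩
    ∑[ y ∈ ys ] (∑[ x ∈ xs ] 𝟙 (does (f x ≟ y))) * h y
      ≡⟨ ∑-cong ys (λ y → cong (_* h y) (sym (multiplicity-map f y xs))) ⟩
    ∑[ y ∈ ys ] multiplicity y (map f xs) * h y ∎
    where
    weighted : ∀ {x} → h (f x) ≡ 0 ⊎ multiplicity (f x) ys ≡ 1 →
      h (f x) ≡ multiplicity (f x) ys * h (f x)
    weighted {x} (inj₁ hfx≡0) rewrite hfx≡0 = sym (*-zeroʳ (multiplicity (f x) ys))
    weighted (inj₂ m≡1)  rewrite m≡1  = sym (*-identityˡ _)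
    expand : ∀ {x} → h (f x) ≡ 0 ⊎ multiplicity (f x) ys ≡ 1 →
      h (f x) ≡ ∑[ y ∈ ys ] 𝟙 (does (f x ≟ y)) * h y
    expand {x} c = trans (weighted c) (sym (∑-select (f x) ys h))

  ∑-reindex : ∀ {B : Set} (f : B → A) (h : A → ℕ) {xs : List A} {ys : List B} →
    All (λ x → h x ≡ 0 ⊎ multiplicity x (map f ys) ≡ 1) xs →
    All (λ y → multiplicity (f y) xs ≡ 1) ys →
    ∑ xs h ≡ ∑[ y ∈ ys ] h (f y)
  ∑-reindex f h {xs} {ys} support image = begin
    ∑ xs h                                                ≡⟨ ∑-fibres id h (map f ys) support ⟩
    ∑[ z ∈ map f ys ] multiplicity z (map id xs) * h z    ≡⟨ ∑-map f ys _ ⟩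
    ∑[ y ∈ ys ] multiplicity (f y) (map id xs) * h (f y)  ≡⟨ ∑-cong-local (All.map counted-once image) ⟩
    ∑[ y ∈ ys ] h (f y)                                   ∎
    where
    counted-once : ∀ {y} → multiplicity (f y) xs ≡ 1 → multiplicity (f y) (map id xs) * h (f y) ≡ h (f y)
    counted-once {y} m≡1 rewrite map-id xs | m≡1 = *-identityˡ (h (f y))

  multiplicity-map-injective : ∀ (f : A → A) → (∀ {x y} → f x ≡ f y → x ≡ y) →
    ∀ x ys → multiplicity (f x) (map f ys) ≡ multiplicity x ys
  multiplicity-map-injective f f-inj x ys =
    trans (∑-map f ys _) (∑-cong ys (λ y → cong 𝟙 (does-⇔ (mk⇔ f-inj (cong f)) (f x ≟ f y) (x ≟ y))))

  multiplicity-filterᵇ : ∀ (p : A → Bool) x ys → multiplicity x (filterᵇ p ys) ≡ multiplicity x ys * 𝟙 (p x)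
  multiplicity-filterᵇ p x ys = begin
    multiplicity x (filterᵇ p ys)            ≡⟨ ∑-filterᵇ p ys _ ⟩
    ∑[ y ∈ ys ] 𝟙 (p y) * 𝟙 (does (x ≟ y))  ≡⟨ ∑-cong ys (λ y → *-comm (𝟙 (p y)) _) ⟩
    ∑[ y ∈ ys ] 𝟙 (does (x ≟ y)) * 𝟙 (p y)  ≡⟨ ∑-select x ys (𝟙 ∘ p) ⟩
    multiplicity x ys * 𝟙 (p x)              ∎

infix 4 _≟ʷ_

_≟ʷ_ : DecidableEquality (List ℕ)
_≟ʷ_ = ≡-dec _≟_

open Multiplicity _≟ʷ_

≡ᵇ-reflects : ∀ a b → Reflects (a ≡ b) (a ≡ᵇ b)
≡ᵇ-reflects a b = proof (a ≟ b)

≡ᵇ-sym : ∀ a b → (a ≡ᵇ b) ≡ (b ≡ᵇ a)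
≡ᵇ-sym a b = does-⇔ (mk⇔ sym sym) (a ≟ b) (b ≟ a)

≡ᵇ-refl : ∀ a → (a ≡ᵇ a) ≡ true
≡ᵇ-refl a = dec-true (a ≟ a) refl

infix 4.5 _∈ᵇ_

_∈ᵇ_ : ℕ → List ℕ → Bool
a ∈ᵇ xs = any (a ≡ᵇ_) xs

∉ᵇ-∷⁻ : ∀ {a y ys} → a ∈ᵇ y ∷ ys ≡ false → (a ≡ᵇ y) ≡ false × a ∈ᵇ ys ≡ false
∉ᵇ-∷⁻ {a} {y} e with a ≡ᵇ y
... | false = refl , e

distinct-∷⁻ : ∀ {x xs} → distinct (x ∷ xs) ≡ true → x ∈ᵇ xs ≡ false × distinct xs ≡ true
distinct-∷⁻ {x} {xs} d with x ∈ᵇ xs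
... | false = refl , d

distinct-∷⁺ : ∀ x xs → x ∈ᵇ xs ≡ false → distinct xs ≡ true → distinct (x ∷ xs) ≡ true
distinct-∷⁺ x xs x∉xs d rewrite x∉xs = d

∧-true⁻ : ∀ {a b} → a ∧ b ≡ true → a ≡ true × b ≡ true
∧-true⁻ {true} b≡true = refl , b≡true

all-true⁻ : ∀ {A : Set} (p : A → Bool) xs → all p xs ≡ true → All (λ x → p x ≡ true) xs
all-true⁻ p []       _   = []
all-true⁻ p (x ∷ xs) pxs with p x in px
... | true = px ∷ all-true⁻ p xs pxs

all-true⁺ : ∀ {A : Set} (p : A → Bool) {xs} → All (λ x → p x ≡ true) xs → all p xs ≡ true
all-true⁺ p []          = refl
all-true⁺ p (px ∷ pxs) rewrite px = all-true⁺ p pxs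

∉ᵇ⇒All≢ : ∀ x xs → x ∈ᵇ xs ≡ false → All (λ z → (x ≡ᵇ z) ≡ false) xs
∉ᵇ⇒All≢ x []       _  = []
∉ᵇ⇒All≢ x (y ∷ xs) x∉ with ∉ᵇ-∷⁻ {x} {y} {xs} x∉
... | x≢y , x∉xs = x≢y ∷ ∉ᵇ⇒All≢ x xs x∉xs

All-∈ᵇ : ∀ {P : ℕ → Set} {xs a} → All P xs → a ∈ᵇ xs ≡ true → P a
All-∈ᵇ {xs = y ∷ xs} {a} (py ∷ pxs) a∈ with a ≡ᵇ y | ≡ᵇ-reflects a y
... | true  | ofʸ refl = py
... | false | _        = All-∈ᵇ pxs a∈

∈ᵇ-∉ᵇ-≢ : ∀ x y xs → y ∈ᵇ xs ≡ true → x ∈ᵇ xs ≡ false → (x ≡ᵇ y) ≡ false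
∈ᵇ-∉ᵇ-≢ x y xs y∈ x∉ with x ≡ᵇ y | ≡ᵇ-reflects x y
... | true  | ofʸ refl = contradiction (trans (sym y∈) x∉) λ ()
... | false | _        = refl

remove : ℕ → List ℕ → List ℕ
remove a = filter (¬? ∘ T? ∘ (a ≡ᵇ_))

dedup : List ℕ → List ℕ
dedup = deduplicateᵇ _≡ᵇ_

∉ᵇ-remove : ∀ a xs → a ∈ᵇ remove a xs ≡ false
∉ᵇ-remove a []       = refl
∉ᵇ-remove a (y ∷ xs) with a ≡ᵇ y in a≢y
... | true                = ∉ᵇ-remove a xs
... | false rewrite a≢y  = ∉ᵇ-remove a xs

∈ᵇ-remove : ∀ a z xs → (a ≡ᵇ z) ≡ false → z ∈ᵇ remove a xs ≡ z ∈ᵇ xs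
∈ᵇ-remove a z []       a≢z = refl
∈ᵇ-remove a z (y ∷ xs) a≢z with a ≡ᵇ y | ≡ᵇ-reflects a y
... | true  | ofʸ refl rewrite ≡ᵇ-sym z a | a≢z = ∈ᵇ-remove a z xs a≢z
... | false | _                                = cong ((z ≡ᵇ y) ∨_) (∈ᵇ-remove a z xs a≢z)

remove-∉ : ∀ a xs → a ∈ᵇ xs ≡ false → remove a xs ≡ xs
remove-∉ a []       _   = refl
remove-∉ a (y ∷ xs) a∉ with a ≡ᵇ y
remove-∉ a (y ∷ xs) () | true
... | false = cong (y ∷_) (remove-∉ a xs a∉)

distinct-remove : ∀ a xs → distinct xs ≡ true → distinct (remove a xs) ≡ true
distinct-remove a []       _ = refl
distinct-remove a (y ∷ xs) d with distinct-∷⁻ {y} {xs} d | a ≡ᵇ y in a≢y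
... | _         , d′ | true  = distinct-remove a xs d′
... | y∉xs , d′ | false =
  distinct-∷⁺ y (remove a xs) (trans (∈ᵇ-remove a y xs a≢y) y∉xs) (distinct-remove a xs d′)

distinct-dedup : ∀ w → distinct (dedup w) ≡ true
distinct-dedup []      = refl
distinct-dedup (a ∷ w) =
  distinct-∷⁺ a (remove a (dedup w)) (∉ᵇ-remove a (dedup w)) (distinct-remove a (dedup w) (distinct-dedup w))

∈ᵇ-dedup : ∀ z w → z ∈ᵇ dedup w ≡ z ∈ᵇ w
∈ᵇ-dedup z []      = refl
∈ᵇ-dedup z (a ∷ w) with z ≡ᵇ a in z≢a
... | true  = refl
... | false = trans (∈ᵇ-remove a z (dedup w) (trans (≡ᵇ-sym a z) z≢a)) (∈ᵇ-dedup z w)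

All-dedup : ∀ {P : ℕ → Set} {w} → All P w → All P (dedup w)
All-dedup []                   = []
All-dedup {w = a ∷ w} (pa ∷ pw) = pa ∷ All.filter⁺ (¬? ∘ T? ∘ (a ≡ᵇ_)) (All-dedup pw)

-- Words and the fibres of dedup

∑-words-suc : ∀ n K (f : List ℕ → ℕ) →
  ∑ (words (suc n) K) f ≡ ∑[ a ∈ upTo K ] ∑[ w ∈ words n K ] f (a ∷ w)
∑-words-suc n K f =
  trans (∑-concatMap _ (upTo K) f) (∑-cong (upTo K) (λ a → ∑-map (a ∷_) (words n K) f))

All-words : ∀ n K → All (λ w → length w ≡ n × All (_< K) w) (words n K)
All-words zero    K = (refl , []) ∷ []
All-words (suc n) K = All.concat⁺ (All.map⁺ (All.map prepend (All.all-upTo K)))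
  where
  prepend : ∀ {a} → a < K → All (λ w → length w ≡ suc n × All (_< K) w) (map (a ∷_) (words n K))
  prepend a<K = All.map⁺ (All.map (λ (|w|≡n , w<K) → cong suc |w|≡n , a<K ∷ w<K) (All-words n K))

multiplicity-words : ∀ m K x → length x ≡ m → All (_< K) x → multiplicity x (words m K) ≡ 1
multiplicity-words zero    K []      _     _           = refl
multiplicity-words (suc m) K (y ∷ x) |x|≡m (y<K ∷ x<K) = begin
  multiplicity (y ∷ x) (words (suc m) K)
    ≡⟨ ∑-words-suc m K _ ⟩
  ∑[ a ∈ upTo K ] ∑[ w ∈ words m K ] 𝟙 ((y ≡ᵇ a) ∧ does (x ≟ʷ w))
    ≡⟨ ∑-upTo-select-∧ K y (words m K) _ y<K ⟩
  multiplicity x (words m K)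
    ≡⟨ multiplicity-words m K x (suc-injective |x|≡m) x<K ⟩
  1 ∎

insertions : ℕ → List ℕ → List (List ℕ)
insertions b []      = (b ∷ []) ∷ []
insertions b (c ∷ s) = (b ∷ c ∷ s) ∷ map (c ∷_) (insertions b s)

length-insertions : ∀ b s → length (insertions b s) ≡ suc (length s)
length-insertions b []      = refl
length-insertions b (c ∷ s) = cong suc (trans (length-map (c ∷_) (insertions b s)) (length-insertions b s))

All-length-insertions : ∀ b s → All (λ t → length t ≡ suc (length s)) (insertions b s)
All-length-insertions b []      = refl ∷ []
All-length-insertions b (c ∷ s) = refl ∷ All.map⁺ (All.map (cong suc) (All-length-insertions b s))

All-insertions : ∀ {P : ℕ → Set} {b s} → P b → All P s → All (All P) (insertions b s)
All-insertions {s = []}    pb []         = (pb ∷ []) ∷ []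
All-insertions {s = c ∷ s} pb (pc ∷ ps) = (pb ∷ pc ∷ ps) ∷ All.map⁺ (All.map (pc ∷_) (All-insertions pb ps))

∉ᵇ-insertions : ∀ z b s → (z ≡ᵇ b) ≡ false → z ∈ᵇ s ≡ false →
  All (λ t → z ∈ᵇ t ≡ false) (insertions b s)
∉ᵇ-insertions z b []      z≢b _   = cong (_∨ false) z≢b ∷ []
∉ᵇ-insertions z b (c ∷ s) z≢b z∉s with ∉ᵇ-∷⁻ {z} {c} {s} z∉s
... | z≢c , z∉s′ =
  cong₂ _∨_ z≢b z∉s ∷ All.map⁺ (All.map (cong₂ _∨_ z≢c) (∉ᵇ-insertions z b s z≢b z∉s′))

distinct-insertions : ∀ b s → b ∈ᵇ s ≡ false → distinct s ≡ true →
  All (λ t → distinct t ≡ true) (insertions b s)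
distinct-insertions b []      _   _  = refl ∷ []
distinct-insertions b (c ∷ s) b∉s ds with ∉ᵇ-∷⁻ {b} {c} {s} b∉s | distinct-∷⁻ {c} {s} ds
... | b≢c , b∉s′ | c∉s , ds′ =
  distinct-∷⁺ b (c ∷ s) b∉s ds ∷
  All.map⁺ (All.zipWith (λ {t} (c∉t , dt) → distinct-∷⁺ c t c∉t dt)
    (∉ᵇ-insertions c b s (trans (≡ᵇ-sym c b) b≢c) c∉s , distinct-insertions b s b∉s′ ds′))

∑-map-∷-≟ : ∀ c y x (L : List (List ℕ)) →
  ∑[ t ∈ map (c ∷_) L ] 𝟙 (does (t ≟ʷ y ∷ x)) ≡ 𝟙 (c ≡ᵇ y) * (∑[ u ∈ L ] 𝟙 (does (u ≟ʷ x)))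
∑-map-∷-≟ c y x L =
  trans (∑-map (c ∷_) L _)
    (trans (∑-cong L (λ u → 𝟙-∧ (c ≡ᵇ y) _)) (∑-distribˡ L (𝟙 (c ≡ᵇ y)) (λ u → 𝟙 (does (u ≟ʷ x)))))

∑-insertions-≟-[] : ∀ b σ → ∑[ t ∈ insertions b σ ] 𝟙 (does (t ≟ʷ [])) ≡ 0
∑-insertions-≟-[] b []      = refl
∑-insertions-≟-[] b (c ∷ s) = trans (∑-map (c ∷_) (insertions b s) _) (∑-zero (insertions b s))

∑-insertions-≟-∷ : ∀ b x σ → b ∈ᵇ σ ≡ false →
  𝟙 (does (σ ≟ʷ x)) ≡ 𝟙 (does (σ ≟ʷ b ∷ x)) + ∑[ t ∈ insertions b σ ] 𝟙 (does (t ≟ʷ b ∷ x))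
∑-insertions-≟-∷ b x []      _   rewrite ≡ᵇ-refl b = sym (+-identityʳ _)
∑-insertions-≟-∷ b x (c ∷ s) b∉σ
  rewrite ≡ᵇ-refl b | ∑-map-∷-≟ c b x (insertions b s)
        | ≡ᵇ-sym c b | proj₁ (∉ᵇ-∷⁻ {b} {c} {s} b∉σ) =
  sym (+-identityʳ _)

remove-fibre : ∀ b x σ → distinct x ≡ true → b ∈ᵇ σ ≡ false →
  𝟙 (does (σ ≟ʷ remove b x)) ≡ 𝟙 (does (σ ≟ʷ x)) + ∑[ t ∈ insertions b σ ] 𝟙 (does (t ≟ʷ x))
remove-fibre b []      σ _  _   =
  sym (trans (cong (𝟙 (does (σ ≟ʷ [])) +_) (∑-insertions-≟-[] b σ)) (+-identityʳ _))
remove-fibre b (y ∷ x) σ dyx b∉σ with b ≡ᵇ y in b≢y | ≡ᵇ-reflects b y | distinct-∷⁻ {y} {x} dyx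
... | true  | ofʸ refl | b∉x , _  rewrite remove-∉ b x b∉x = ∑-insertions-≟-∷ b x σ b∉σ
... | false | _        | _   , dx = keep-y σ b∉σ
  where
  keep-y : ∀ σ → b ∈ᵇ σ ≡ false →
    𝟙 (does (σ ≟ʷ y ∷ remove b x)) ≡
    𝟙 (does (σ ≟ʷ y ∷ x)) + ∑[ t ∈ insertions b σ ] 𝟙 (does (t ≟ʷ y ∷ x))
  keep-y []      _ rewrite b≢y = refl
  keep-y (c ∷ s) b∉cs rewrite ∑-map-∷-≟ c y x (insertions b s) | b≢y with c ≡ᵇ y
  ... | true  = trans (remove-fibre b x s dx (proj₂ (∉ᵇ-∷⁻ {b} {c} {s} b∉cs)))
                      (cong (𝟙 (does (s ≟ʷ x)) +_) (sym (+-identityʳ _)))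
  ... | false = refl

-- The recursion of S: dedup (a ∷ w) = b ∷ σ exactly when a = b and dedup w is σ or one
-- of the length σ + 1 insertions of b into σ.
dedup-fibre : ∀ n K σ → distinct σ ≡ true → All (_< K) σ →
  ∑[ w ∈ words n K ] 𝟙 (does (σ ≟ʷ dedup w)) ≡ S n (length σ)
dedup-fibre zero    K []      _   _ = refl
dedup-fibre zero    K (_ ∷ _) _   _ = refl
dedup-fibre (suc n) K []      _   _ =
  trans (∑-words-suc n K _) (trans (∑-cong (upTo K) (λ _ → ∑-zero (words n K))) (∑-zero (upTo K)))
dedup-fibre (suc n) K (b ∷ σ) dbσ (b<K ∷ σ<K) = begin
  ∑[ w ∈ words (suc n) K ] 𝟙 (does (b ∷ σ ≟ʷ dedup w))
    ≡⟨ ∑-words-suc n K _ ⟩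
  ∑[ a ∈ upTo K ] ∑[ w ∈ W ] 𝟙 ((b ≡ᵇ a) ∧ does (σ ≟ʷ remove a (dedup w)))
    ≡⟨ ∑-upTo-select-∧ K b W _ b<K ⟩
  ∑[ w ∈ W ] 𝟙 (does (σ ≟ʷ remove b (dedup w)))
    ≡⟨ ∑-cong W (λ w → remove-fibre b (dedup w) σ (distinct-dedup w) b∉σ) ⟩
  ∑[ w ∈ W ] (𝟙 (does (σ ≟ʷ dedup w)) + ∑[ t ∈ insertions b σ ] 𝟙 (does (t ≟ʷ dedup w)))
    ≡⟨ ∑-distrib-+ W _ _ ⟩
  ∑[ w ∈ W ] 𝟙 (does (σ ≟ʷ dedup w)) + ∑[ w ∈ W ] ∑[ t ∈ insertions b σ ] 𝟙 (does (t ≟ʷ dedup w))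
    ≡⟨ cong (_ +_) (∑-comm W (insertions b σ) _) ⟩
  ∑[ w ∈ W ] 𝟙 (does (σ ≟ʷ dedup w)) + ∑[ t ∈ insertions b σ ] ∑[ w ∈ W ] 𝟙 (does (t ≟ʷ dedup w))
    ≡⟨ cong₂ _+_ (dedup-fibre n K σ dσ σ<K) (∑-cong-local (All.map fibre-of-insertion insertion-facts)) ⟩
  S n m + ∑[ t ∈ insertions b σ ] S n (suc m)
    ≡⟨ cong (S n m +_) (trans (∑-const (insertions b σ) (S n (suc m)))
                              (cong (_* S n (suc m)) (length-insertions b σ))) ⟩
  S n m + suc m * S n (suc m)
    ≡⟨ +-comm (S n m) _ ⟩
  S (suc n) (suc m) ∎
  where
  W = words n K
  m = length σ
  b∉σ = proj₁ (distinct-∷⁻ {b} {σ} dbσ)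
  dσ  = proj₂ (distinct-∷⁻ {b} {σ} dbσ)
  insertion-facts : All (λ t → (distinct t ≡ true × All (_< K) t) × length t ≡ suc m) (insertions b σ)
  insertion-facts =
    All.zip (All.zip (distinct-insertions b σ b∉σ dσ , All-insertions b<K σ<K) , All-length-insertions b σ)
  fibre-of-insertion : ∀ {t} → (distinct t ≡ true × All (_< K) t) × length t ≡ suc m →
    ∑[ w ∈ W ] 𝟙 (does (t ≟ʷ dedup w)) ≡ S n (suc m)
  fibre-of-insertion {t} ((dt , t<K) , |t|) = trans (dedup-fibre n K t dt t<K) (cong (S n) |t|)

indexOf : ℕ → List ℕ → ℕ
indexOf a []       = 0
indexOf a (z ∷ zs) = if a ≡ᵇ z then 0 else suc (indexOf a zs)

module _ (f : ℕ → ℕ) (P : ℕ → Set) (f-inj : ∀ a y → P a → P y → f a ≡ f y → a ≡ y) where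

  ≡ᵇ-map : ∀ a y → P a → P y → (f a ≡ᵇ f y) ≡ (a ≡ᵇ y)
  ≡ᵇ-map a y pa py = does-⇔ (mk⇔ (f-inj a y pa py) (cong f)) (f a ≟ f y) (a ≟ y)

  ∈ᵇ-map : ∀ a L → P a → All P L → f a ∈ᵇ map f L ≡ a ∈ᵇ L
  ∈ᵇ-map a []      pa []         = refl
  ∈ᵇ-map a (y ∷ L) pa (py ∷ pys) = cong₂ _∨_ (≡ᵇ-map a y pa py) (∈ᵇ-map a L pa pys)

  indexOf-map : ∀ a L → P a → All P L → indexOf (f a) (map f L) ≡ indexOf a L
  indexOf-map a []      pa []         = refl
  indexOf-map a (y ∷ L) pa (py ∷ pys) =
    cong₂ (λ e i → if e then 0 else suc i) (≡ᵇ-map a y pa py) (indexOf-map a L pa pys)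

  distinct-map : ∀ L → All P L → distinct (map f L) ≡ distinct L
  distinct-map []      []         = refl
  distinct-map (a ∷ L) (pa ∷ pas) = cong₂ _∧_ (cong not (∈ᵇ-map a L pa pas)) (distinct-map L pas)

∈ᵇ-map-suc : ∀ a L → suc a ∈ᵇ map suc L ≡ a ∈ᵇ L
∈ᵇ-map-suc a L = ∈ᵇ-map suc (λ _ → ⊤) (λ _ _ _ _ → suc-injective) a L tt (All.universal _ L)

indexOf-map-suc : ∀ a L → indexOf (suc a) (map suc L) ≡ indexOf a L
indexOf-map-suc a L = indexOf-map suc (λ _ → ⊤) (λ _ _ _ _ → suc-injective) a L tt (All.universal _ L)

distinct-map-suc : ∀ L → distinct (map suc L) ≡ distinct L
distinct-map-suc L = distinct-map suc (λ _ → ⊤) (λ _ _ _ _ → suc-injective) L (All.universal _ L)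

0∉ᵇmap-suc : ∀ L → 0 ∈ᵇ map suc L ≡ false
0∉ᵇmap-suc []      = refl
0∉ᵇmap-suc (_ ∷ L) = 0∉ᵇmap-suc L

applyUpTo-suc : ∀ m → applyUpTo suc m ≡ map suc (upTo m)
applyUpTo-suc m = sym (map-upTo suc m)

∈ᵇ-upTo : ∀ m z → z < m → z ∈ᵇ upTo m ≡ true
∈ᵇ-upTo (suc m) zero    _         = refl
∈ᵇ-upTo (suc m) (suc z) (s≤s z<m) = begin
  suc z ∈ᵇ upTo (suc m)     ≡⟨ cong (λ L → suc z ∈ᵇ 0 ∷ L) (applyUpTo-suc m) ⟩
  suc z ∈ᵇ map suc (upTo m) ≡⟨ ∈ᵇ-map-suc z (upTo m) ⟩
  z ∈ᵇ upTo m               ≡⟨ ∈ᵇ-upTo m z z<m ⟩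
  true                      ∎

distinct-upTo : ∀ m → distinct (upTo m) ≡ true
distinct-upTo zero    = refl
distinct-upTo (suc m) rewrite applyUpTo-suc m =
  distinct-∷⁺ 0 (map suc (upTo m)) (0∉ᵇmap-suc (upTo m))
    (trans (distinct-map-suc (upTo m)) (distinct-upTo m))

indexOf-upTo : ∀ m a → a < m → indexOf a (upTo m) ≡ a
indexOf-upTo (suc m) zero    _         = refl
indexOf-upTo (suc m) (suc a) (s≤s a<m) rewrite applyUpTo-suc m =
  cong suc (trans (indexOf-map-suc a (upTo m)) (indexOf-upTo m a a<m))

length-remove-< : ∀ y M → y ∈ᵇ M ≡ true → length (remove y M) < length M
length-remove-< y (z ∷ M) y∈M with y ≡ᵇ z
... | true  = s≤s (length-filter (¬? ∘ T? ∘ (y ≡ᵇ_)) M)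
... | false = s≤s (length-remove-< y M y∈M)

pigeonhole : ∀ xs ys → distinct xs ≡ true → All (λ x → x ∈ᵇ ys ≡ true) xs → length xs ≤ length ys
pigeonhole []       ys _   _               = z≤n
pigeonhole (x ∷ xs) ys dxs (x∈ys ∷ xs⊆ys) =
  ≤-trans (s≤s (pigeonhole xs (remove x ys) dxs′ xs⊆ys∖x)) (length-remove-< x ys x∈ys)
  where
  x∉xs = proj₁ (distinct-∷⁻ {x} {xs} dxs)
  dxs′ = proj₂ (distinct-∷⁻ {x} {xs} dxs)
  xs⊆ys∖x : All (λ z → z ∈ᵇ remove x ys ≡ true) xs
  xs⊆ys∖x = All.zipWith (λ {z} (z∈ys , x≢z) → trans (∈ᵇ-remove x z ys x≢z) z∈ys)
              (xs⊆ys , ∉ᵇ⇒All≢ x xs x∉xs)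

-- Permutations and their inverses

IsPermutation : ℕ → List ℕ → Set
IsPermutation m σ = length σ ≡ m × All (_< m) σ × distinct σ ≡ true

All-permutations : ∀ m → All (IsPermutation m) (permutations m)
All-permutations m = All.zipWith (λ ((|σ| , σ<m) , dσ) → |σ| , σ<m , Equivalence.to T-≡ dσ)
  (All.filter⁺ (T? ∘ distinct) (All-words m m) , All.all-filter (T? ∘ distinct) (words m m))

multiplicity-permutations : ∀ m σ → IsPermutation m σ → multiplicity σ (permutations m) ≡ 1
multiplicity-permutations m σ (|σ| , σ<m , dσ) =
  trans (multiplicity-filterᵇ distinct σ (words m m)) (cong₂ _*_ (multiplicity-words m m σ |σ| σ<m) (cong 𝟙 dσ))

permutation-covers : ∀ m σ → IsPermutation m σ → ∀ a → a < m → a ∈ᵇ σ ≡ true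
permutation-covers m σ (|σ| , σ<m , dσ) a a<m with a ∈ᵇ σ in a∉σ
... | true  = refl
... | false = contradiction (subst₂ _<_ |σ| (length-upTo m) σ-too-short) (<-irrefl refl)
  where
  σ⊆upTo∖a : All (λ z → z ∈ᵇ remove a (upTo m) ≡ true) σ
  σ⊆upTo∖a = All.zipWith (λ {z} (z<m , a≢z) → trans (∈ᵇ-remove a z (upTo m) a≢z) (∈ᵇ-upTo m z z<m))
               (σ<m , ∉ᵇ⇒All≢ a σ a∉σ)
  σ-too-short : length σ < length (upTo m)
  σ-too-short = ≤-<-trans (pigeonhole σ (remove a (upTo m)) dσ σ⊆upTo∖a)
                          (length-remove-< a (upTo m) (∈ᵇ-upTo m a a<m))

covers : ℕ → List ℕ → Bool
covers k σ = all (_∈ᵇ σ) (upTo k)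

covering-permutation : ∀ k σ → distinct σ ≡ true → All (_< k) σ → covers k σ ≡ true → IsPermutation k σ
covering-permutation k σ dσ σ<k cov = ≤-antisym |σ|≤k k≤|σ| , σ<k , dσ
  where
  |σ|≤k : length σ ≤ k
  |σ|≤k = subst (length σ ≤_) (length-upTo k)
            (pigeonhole σ (upTo k) dσ (All.map (λ {z} → ∈ᵇ-upTo k z) σ<k))
  k≤|σ| : k ≤ length σ
  k≤|σ| = subst (_≤ length σ) (length-upTo k)
            (pigeonhole (upTo k) σ (distinct-upTo k) (all-true⁻ (_∈ᵇ σ) (upTo k) cov))

indexOf-< : ∀ a xs → a ∈ᵇ xs ≡ true → indexOf a xs < length xs
indexOf-< a (y ∷ xs) a∈ with a ≡ᵇ y
... | true  = s≤s z≤n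
... | false = s≤s (indexOf-< a xs a∈)

indexOf-injective : ∀ a y xs → a ∈ᵇ xs ≡ true → y ∈ᵇ xs ≡ true →
  indexOf a xs ≡ indexOf y xs → a ≡ y
indexOf-injective a y (z ∷ xs) a∈ y∈ eq with a ≡ᵇ z | ≡ᵇ-reflects a z | y ≡ᵇ z | ≡ᵇ-reflects y z
... | true  | ofʸ refl | true  | ofʸ refl = refl
... | true  | _        | false | _        = contradiction eq λ ()
... | false | _        | true  | _        = contradiction eq λ ()
... | false | _        | false | _        = indexOf-injective a y xs a∈ y∈ (suc-injective eq)

nth : ℕ → List ℕ → ℕ
nth _       []       = 0
nth zero    (x ∷ _)  = x
nth (suc j) (_ ∷ xs) = nth j xs

∈ᵇ-nth : ∀ j xs → j < length xs → nth j xs ∈ᵇ xs ≡ true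
∈ᵇ-nth zero    (x ∷ xs) _         rewrite ≡ᵇ-refl x         = refl
∈ᵇ-nth (suc j) (x ∷ xs) (s≤s j<n) rewrite ∈ᵇ-nth j xs j<n = ∨-zeroʳ _

indexOf-nth : ∀ j xs → distinct xs ≡ true → j < length xs → indexOf (nth j xs) xs ≡ j
indexOf-nth zero    (x ∷ xs) _   _         rewrite ≡ᵇ-refl x = refl
indexOf-nth (suc j) (x ∷ xs) dxs (s≤s j<n) with distinct-∷⁻ {x} {xs} dxs
... | x∉xs , dxs′ rewrite ≡ᵇ-sym (nth j xs) x | ∈ᵇ-∉ᵇ-≢ x (nth j xs) xs (∈ᵇ-nth j xs j<n) x∉xs =
  cong suc (indexOf-nth j xs dxs′ j<n)

map-nth-upTo : ∀ xs → map (λ j → nth j xs) (upTo (length xs)) ≡ xs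
map-nth-upTo []       = refl
map-nth-upTo (x ∷ xs) = cong (x ∷_) (begin
  map (λ j → nth j (x ∷ xs)) (applyUpTo suc (length xs))    ≡⟨ cong (map _) (applyUpTo-suc (length xs)) ⟩
  map (λ j → nth j (x ∷ xs)) (map suc (upTo (length xs)))   ≡⟨ sym (map-∘ (upTo (length xs))) ⟩
  map (λ j → nth j xs) (upTo (length xs))                   ≡⟨ map-nth-upTo xs ⟩
  xs                                                        ∎)

inverse : ℕ → List ℕ → List ℕ
inverse m σ = map (λ a → indexOf a σ) (upTo m)

module _ {m σ} (σ-perm : IsPermutation m σ) where

  private
    |σ| = proj₁ σ-perm
    σ<m = proj₁ (proj₂ σ-perm)
    dσ  = proj₂ (proj₂ σ-perm)

    covered : ∀ a → a < m → a ∈ᵇ σ ≡ true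
    covered = permutation-covers m σ σ-perm

    indexOf-inj : ∀ a y → a < m → y < m → indexOf a σ ≡ indexOf y σ → a ≡ y
    indexOf-inj a y a<m y<m = indexOf-injective a y σ (covered a a<m) (covered y y<m)

  inverse-permutation : IsPermutation m (inverse m σ)
  inverse-permutation =
    trans (length-map _ (upTo m)) (length-upTo m) ,
    All.map⁺ (All.map (λ {a} a<m → subst (indexOf a σ <_) |σ| (indexOf-< a σ (covered a a<m)))
                      (All.all-upTo m)) ,
    trans (distinct-map (λ a → indexOf a σ) (_< m) indexOf-inj (upTo m) (All.all-upTo m)) (distinct-upTo m)

  inverse-involutive : inverse m (inverse m σ) ≡ σ
  inverse-involutive = begin
    map (λ j → indexOf j (inverse m σ)) (upTo m)
      ≡⟨ map-cong-local (All.map (λ {j} → indexOf-inverse j) (All.all-upTo m)) ⟩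
    map (λ j → nth j σ) (upTo m)
      ≡⟨ cong (λ n → map (λ j → nth j σ) (upTo n)) (sym |σ|) ⟩
    map (λ j → nth j σ) (upTo (length σ))
      ≡⟨ map-nth-upTo σ ⟩
    σ ∎
    where
    indexOf-inverse : ∀ j → j < m → indexOf j (inverse m σ) ≡ nth j σ
    indexOf-inverse j j<m = begin
      indexOf j (inverse m σ)
        ≡⟨ cong (λ i → indexOf i (inverse m σ)) (sym (indexOf-nth j σ dσ j<|σ|)) ⟩
      indexOf (indexOf (nth j σ) σ) (map (λ a → indexOf a σ) (upTo m))
        ≡⟨ indexOf-map (λ a → indexOf a σ) (_< m) indexOf-inj (nth j σ) (upTo m) σⱼ<m (All.all-upTo m) ⟩
      indexOf (nth j σ) (upTo m)
        ≡⟨ indexOf-upTo m (nth j σ) σⱼ<m ⟩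
      nth j σ ∎
      where
      j<|σ| = subst (j <_) (sym |σ|) j<m
      σⱼ<m  = All-∈ᵇ σ<m (∈ᵇ-nth j σ j<|σ|)

isJust-firstOcc : ∀ a w → isJust (firstOcc a w) ≡ a ∈ᵇ w
isJust-firstOcc a []      = refl
isJust-firstOcc a (c ∷ w) with a ≡ᵇ c
... | true  = refl
... | false with firstOcc a w | isJust-firstOcc a w
...   | just _  | a∈w = a∈w
...   | nothing | a∈w = a∈w

opener : ℕ → List ℕ → ℕ
opener a w = fromMaybe0 (firstOcc a w)

opener-indexOf : ∀ a w → a ∈ᵇ w ≡ true → opener a w ≡ suc (indexOf a w)
opener-indexOf a (c ∷ w) a∈w with a ≡ᵇ c
... | true  = refl
... | false with firstOcc a w | opener-indexOf a w a∈w
...   | just p  | p≡1+i = cong suc p≡1+i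
...   | nothing | ()

indexOf-∷-<ᵇ : ∀ a b z X Y → (indexOf b X <ᵇ indexOf a X) ≡ (indexOf b Y <ᵇ indexOf a Y) →
  (indexOf b (z ∷ X) <ᵇ indexOf a (z ∷ X)) ≡ (indexOf b (z ∷ Y) <ᵇ indexOf a (z ∷ Y))
indexOf-∷-<ᵇ a b z X Y same with b ≡ᵇ z | a ≡ᵇ z
... | true  | true  = refl
... | true  | false = refl
... | false | true  = refl
... | false | false = same

indexOf-remove-<ᵇ : ∀ a b c L → (a ≡ᵇ c) ≡ false → (b ≡ᵇ c) ≡ false →
  (indexOf b (remove c L) <ᵇ indexOf a (remove c L)) ≡ (indexOf b L <ᵇ indexOf a L)
indexOf-remove-<ᵇ a b c []      _   _   = refl
indexOf-remove-<ᵇ a b c (z ∷ L) a≢c b≢c with c ≡ᵇ z | ≡ᵇ-reflects c z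
... | true  | ofʸ refl rewrite a≢c | b≢c = indexOf-remove-<ᵇ a b c L a≢c b≢c
... | false | _        = indexOf-∷-<ᵇ a b z (remove c L) L (indexOf-remove-<ᵇ a b c L a≢c b≢c)

indexOf-dedup-<ᵇ : ∀ w a b → a ∈ᵇ w ≡ true → b ∈ᵇ w ≡ true →
  (indexOf b w <ᵇ indexOf a w) ≡ (indexOf b (dedup w) <ᵇ indexOf a (dedup w))
indexOf-dedup-<ᵇ (c ∷ w) a b a∈w b∈w with b ≡ᵇ c in b≢c | a ≡ᵇ c in a≢c
... | true  | true  = refl
... | true  | false = refl
... | false | true  = refl
... | false | false =
  trans (indexOf-dedup-<ᵇ w a b a∈w b∈w) (sym (indexOf-remove-<ᵇ a b c (dedup w) a≢c b≢c))

descents-map-cong : ∀ (f g : ℕ → ℕ) {P : ℕ → Set} {L} → All P L →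
  (∀ {a b} → P a → P b → (f b <ᵇ f a) ≡ (g b <ᵇ g a)) → descents (map f L) ≡ descents (map g L)
descents-map-cong f g []                 same = refl
descents-map-cong f g (_ ∷ [])           same = refl
descents-map-cong f g (pa ∷ pb ∷ pL) same =
  cong₂ _+_ (cong (λ e → if e then 1 else 0) (same pa pb)) (descents-map-cong f g (pb ∷ pL) same)

surjective-covers : ∀ k w → surjective k w ≡ covers k (dedup w)
surjective-covers k w = cong and (map-cong (λ a → trans (isJust-firstOcc a w) (sym (∈ᵇ-dedup a w))) (upTo k))

-- The openers of w are ordered like the positions of the block labels in dedup w.
descents-openers : ∀ k w → covers k (dedup w) ≡ true → descents (openers k w) ≡ descents (inverse k (dedup w))
descents-openers k w cov =
  descents-map-cong (λ a → opener a w) (λ a → indexOf a (dedup w)) letters-of-w same-order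
  where
  letters-of-w : All (λ a → a ∈ᵇ w ≡ true) (upTo k)
  letters-of-w = All.map (λ {a} a∈ → trans (sym (∈ᵇ-dedup a w)) a∈) (all-true⁻ (_∈ᵇ dedup w) (upTo k) cov)
  same-order : ∀ {a b} → a ∈ᵇ w ≡ true → b ∈ᵇ w ≡ true →
    (opener b w <ᵇ opener a w) ≡ (indexOf b (dedup w) <ᵇ indexOf a (dedup w))
  same-order {a} {b} a∈w b∈w rewrite opener-indexOf a w a∈w | opener-indexOf b w b∈w =
    indexOf-dedup-<ᵇ w a b a∈w b∈w

lift : List ℕ → List ℕ
lift τ = 0 ∷ map suc τ

lift-injective : ∀ {τ τ′} → lift τ ≡ lift τ′ → τ ≡ τ′
lift-injective = map-injective suc-injective ∘ ∷-injectiveʳ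

lift-permutation : ∀ {m τ} → IsPermutation m τ → IsPermutation (suc m) (lift τ)
lift-permutation {τ = τ} (|τ| , τ<m , dτ) =
  cong suc (trans (length-map suc τ) |τ|) ,
  s≤s z≤n ∷ All.map⁺ (All.map s≤s τ<m) ,
  distinct-∷⁺ 0 (map suc τ) (0∉ᵇmap-suc τ) (trans (distinct-map-suc τ) dτ)

inverse-lift : ∀ m τ → inverse (suc m) (lift τ) ≡ lift (inverse m τ)
inverse-lift m τ = cong (0 ∷_) (begin
  map (λ a → indexOf a (lift τ)) (applyUpTo suc m)
    ≡⟨ cong (map _) (applyUpTo-suc m) ⟩
  map (λ a → indexOf a (lift τ)) (map suc (upTo m))
    ≡⟨ sym (map-∘ (upTo m)) ⟩
  map (λ a → suc (indexOf (suc a) (map suc τ))) (upTo m)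
    ≡⟨ map-cong (λ a → cong suc (indexOf-map-suc a τ)) (upTo m) ⟩
  map (λ a → suc (indexOf a τ)) (upTo m)
    ≡⟨ map-∘ (upTo m) ⟩
  map suc (inverse m τ) ∎)

descents-lift : ∀ τ → descents (lift τ) ≡ descents τ
descents-lift τ = begin
  descents (0 ∷ map suc τ) ≡⟨ descents-0∷ (map suc τ) ⟩
  descents (map suc τ)     ≡⟨ descents-map-cong suc id (All.universal (λ _ → tt) τ) (λ _ _ → refl) ⟩
  descents (map id τ)      ≡⟨ cong descents (map-id τ) ⟩
  descents τ               ∎
  where
  descents-0∷ : ∀ L → descents (0 ∷ L) ≡ descents L
  descents-0∷ []      = refl
  descents-0∷ (_ ∷ _) = refl

unlift : ∀ {m σ} → IsPermutation (suc m) (0 ∷ σ) → ∃ λ τ → IsPermutation m τ × lift τ ≡ 0 ∷ σ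
unlift {m} {σ} (|0σ| , _ ∷ σ<1+m , d0σ) = map pred σ , τ-perm , cong (0 ∷_) lift-pred
  where
  nonzero : All (λ y → (0 ≡ᵇ y) ≡ false) σ
  nonzero = ∉ᵇ⇒All≢ 0 σ (proj₁ (distinct-∷⁻ {0} {σ} d0σ))
  lift-pred : map suc (map pred σ) ≡ σ
  lift-pred = trans (sym (map-∘ σ)) (map-id-local (All.map (λ { {suc y} _ → refl ; {zero} () }) nonzero))
  τ-perm : IsPermutation m (map pred σ)
  τ-perm =
    trans (length-map pred σ) (suc-injective |0σ|) ,
    All.map⁺ (All.zipWith (λ { {suc y} (s≤s y<m , _) → y<m ; {zero} (_ , ()) }) (σ<1+m , nonzero)) ,
    trans (sym (distinct-map-suc (map pred σ))) (trans (cong distinct lift-pred) (proj₂ (distinct-∷⁻ {0} {σ} d0σ)))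

-- Counting cyclically ordered partitions

-- For σ = dedup w: w is a canonical cyclically ordered partition with k blocks whose
-- openers have d descents.
admissible : ℕ → ℕ → List ℕ → Bool
admissible k d σ = startsWithZero σ ∧ covers k σ ∧ (descents (inverse k σ) ≡ᵇ d)

startsWithZero-dedup : ∀ w → startsWithZero (dedup w) ≡ startsWithZero w
startsWithZero-dedup []      = refl
startsWithZero-dedup (_ ∷ _) = refl

cycPartCount-dedup : ∀ n k d → cycPartCount n k d ≡ ∑[ w ∈ words n k ] 𝟙 (admissible k d (dedup w))
cycPartCount-dedup n k d = begin
  cycPartCount n k d
    ≡⟨ length-filterᵇ _ (cyclicPartitions n k) ⟩
  ∑[ w ∈ cyclicPartitions n k ] 𝟙 (descents (openers k w) ≡ᵇ d)
    ≡⟨ ∑-filterᵇ _ (words n k) _ ⟩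
  ∑[ w ∈ words n k ] 𝟙 (startsWithZero w ∧ surjective k w) * 𝟙 (descents (openers k w) ≡ᵇ d)
    ≡⟨ ∑-cong (words n k) via-dedup ⟩
  ∑[ w ∈ words n k ] 𝟙 (admissible k d (dedup w)) ∎
  where
  via-dedup : ∀ w → 𝟙 (startsWithZero w ∧ surjective k w) * 𝟙 (descents (openers k w) ≡ᵇ d) ≡
                    𝟙 (admissible k d (dedup w))
  via-dedup w rewrite startsWithZero-dedup w | surjective-covers k w
    with startsWithZero w | covers k (dedup w) in cov
  ... | false | _     = refl
  ... | true  | false = refl
  ... | true  | true  rewrite descents-openers k w cov = +-identityʳ _

∑-admissible-dedup : ∀ n k d →
  ∑[ w ∈ words n k ] 𝟙 (admissible k d (dedup w)) ≡ S n k * (∑[ σ ∈ permutations k ] 𝟙 (admissible k d σ))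
∑-admissible-dedup n k d = begin
  ∑[ w ∈ W ] 𝟙 (admissible k d (dedup w))
    ≡⟨ ∑-fibres dedup (𝟙 ∘ admissible k d) P (All.map counted-once (All-words n k)) ⟩
  ∑[ σ ∈ P ] multiplicity σ (map dedup W) * 𝟙 (admissible k d σ)
    ≡⟨ ∑-cong-local (All.map (λ σ-perm → cong (_* _) (fibre σ-perm)) (All-permutations k)) ⟩
  ∑[ σ ∈ P ] S n k * 𝟙 (admissible k d σ)
    ≡⟨ ∑-distribˡ P (S n k) _ ⟩
  S n k * (∑[ σ ∈ P ] 𝟙 (admissible k d σ)) ∎
  where
  W = words n k
  P = permutations k
  counted-once : ∀ {w} → length w ≡ n × All (_< k) w →
    𝟙 (admissible k d (dedup w)) ≡ 0 ⊎ multiplicity (dedup w) P ≡ 1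
  counted-once {w} (_ , w<k) with admissible k d (dedup w) in adm
  ... | false = inj₁ refl
  ... | true  = inj₂ (multiplicity-permutations k (dedup w)
                       (covering-permutation k (dedup w) (distinct-dedup w) (All-dedup w<k) covered))
    where covered = proj₁ (∧-true⁻ (proj₂ (∧-true⁻ {startsWithZero (dedup w)} adm)))
  fibre : ∀ {σ} → IsPermutation k σ → multiplicity σ (map dedup W) ≡ S n k
  fibre {σ} (|σ| , σ<k , dσ) =
    trans (∑-map dedup W _) (trans (dedup-fibre n k σ dσ σ<k) (cong (S n) |σ|))

∑-admissible-lift : ∀ m d →
  ∑[ σ ∈ permutations (suc m) ] 𝟙 (admissible (suc m) d σ) ≡
  ∑[ τ ∈ permutations m ] 𝟙 (descents (inverse m τ) ≡ᵇ d)
∑-admissible-lift m d =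
  trans (∑-reindex lift (𝟙 ∘ admissible (suc m) d) support image)
        (∑-cong-local (All.map value (All-permutations m)))
  where
  P = permutations m
  image : All (λ τ → multiplicity (lift τ) (permutations (suc m)) ≡ 1) P
  image = All.map (λ {τ} τ-perm → multiplicity-permutations (suc m) (lift τ) (lift-permutation τ-perm))
            (All-permutations m)
  preimage : ∀ σ → IsPermutation (suc m) σ →
    𝟙 (admissible (suc m) d σ) ≡ 0 ⊎ multiplicity σ (map lift P) ≡ 1
  preimage []          _      = inj₁ refl
  preimage (suc _ ∷ _) _      = inj₁ refl
  preimage (zero ∷ σ)  σ-perm with unlift σ-perm
  ... | τ , τ-perm , refl =
    inj₂ (trans (multiplicity-map-injective lift lift-injective τ P) (multiplicity-permutations m τ τ-perm))
  support : All (λ σ → 𝟙 (admissible (suc m) d σ) ≡ 0 ⊎ multiplicity σ (map lift P) ≡ 1)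
              (permutations (suc m))
  support = All.map (λ {σ} → preimage σ) (All-permutations (suc m))
  lift-covers : ∀ {τ} → IsPermutation m τ → covers (suc m) (lift τ) ≡ true
  lift-covers {τ} τ-perm = all-true⁺ (_∈ᵇ lift τ)
    (All.map (λ {a} → permutation-covers (suc m) (lift τ) (lift-permutation τ-perm) a) (All.all-upTo (suc m)))
  value : ∀ {τ} → IsPermutation m τ →
    𝟙 (admissible (suc m) d (lift τ)) ≡ 𝟙 (descents (inverse m τ) ≡ᵇ d)
  value {τ} τ-perm rewrite lift-covers τ-perm | inverse-lift m τ | descents-lift (inverse m τ) = refl

∑-descents-inverse : ∀ m d →
  ∑[ τ ∈ permutations m ] 𝟙 (descents (inverse m τ) ≡ᵇ d) ≡
  ∑[ π ∈ permutations m ] 𝟙 (descents π ≡ᵇ d)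
∑-descents-inverse m d = sym (∑-reindex (inverse m) (λ π → 𝟙 (descents π ≡ᵇ d)) support image)
  where
  P = permutations m
  image : All (λ τ → multiplicity (inverse m τ) P ≡ 1) P
  image = All.map (λ {τ} τ-perm → multiplicity-permutations m (inverse m τ) (inverse-permutation τ-perm))
            (All-permutations m)
  swap-inverse : ∀ {π τ} → IsPermutation m π → IsPermutation m τ →
    𝟙 (does (inverse m τ ≟ʷ π)) ≡ 𝟙 (does (inverse m π ≟ʷ τ))
  swap-inverse {π} {τ} π-perm τ-perm =
    cong 𝟙 (does-⇔ (mk⇔ (flip τ-perm) (flip π-perm)) (inverse m τ ≟ʷ π) (inverse m π ≟ʷ τ))
    where
    flip : ∀ {x y} → IsPermutation m x → inverse m x ≡ y → inverse m y ≡ x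
    flip x-perm refl = inverse-involutive x-perm
  support : All (λ π → 𝟙 (descents π ≡ᵇ d) ≡ 0 ⊎ multiplicity π (map (inverse m) P) ≡ 1) P
  support = All.map (λ {π} π-perm → inj₂ (begin
    multiplicity π (map (inverse m) P)
      ≡⟨ multiplicity-map (inverse m) π P ⟩
    ∑[ τ ∈ P ] 𝟙 (does (inverse m τ ≟ʷ π))
      ≡⟨ ∑-cong-local (All.map (swap-inverse π-perm) (All-permutations m)) ⟩
    multiplicity (inverse m π) P
      ≡⟨ multiplicity-permutations m (inverse m π) (inverse-permutation π-perm) ⟩
    1 ∎)) (All-permutations m)

proposition3 : (n k i : ℕ) → 1 ≤ i → i ≤ k ∸ 1 → 1 ≤ k → 1 ≤ n → k ∸ 1 ≤ n ∸ 1 →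
    S n k * eulerian (k ∸ 1) i ≡ cycPartCount n k (i ∸ 1)
proposition3 n zero    i _ _ () _ _
proposition3 n (suc m) i _ _ _  _ _ = sym (begin
  cycPartCount n (suc m) d
    ≡⟨ cycPartCount-dedup n (suc m) d ⟩
  ∑[ w ∈ words n (suc m) ] 𝟙 (admissible (suc m) d (dedup w))
    ≡⟨ ∑-admissible-dedup n (suc m) d ⟩
  S n (suc m) * (∑[ σ ∈ permutations (suc m) ] 𝟙 (admissible (suc m) d σ))
    ≡⟨ cong (S n (suc m) *_) (trans (∑-admissible-lift m d) (∑-descents-inverse m d)) ⟩
  S n (suc m) * (∑[ π ∈ permutations m ] 𝟙 (descents π ≡ᵇ d))
    ≡⟨ cong (S n (suc m) *_) (sym (length-filterᵇ _ (permutations m))) ⟩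
  S n (suc m) * eulerian m i ∎)
  where d = i ∸ 1
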